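{- The logic $\mathsf{QLP}(\mathsf{FP})_{\emptyset}$ is inconsistent.
   Context: Fix countably many justification variables, propositional variables, and primitive function symbols of each arity $n\ge0$; a primitive term is $f(x_1,\dots,x_n)$. Terms of $\mathsf{QLP}$: $t::= x\mid f(x_1,\dots,x_n)\mid t\cdot t\mid t+t\mid !t\mid(t\forall x)$ ($x$ bound in $(t\forall x)$). Formulas: $A::= p\mid\bot\mid\neg A\mid A\wedge A\mid A\vee A\mid A\rightarrow A\mid t:A\mid(\forall x)A\mid(\exists x)A$. Axioms: all propositional tautologies; Q1: $(\forall x)A(x)\rightarrow A(t)$, $t$ free for $x$; Q2: $(\forall x)(A\rightarrow B(x))\rightarrow(A\rightarrow(\forall x)B(x))$, $x$ not free in $A$; Q3: $A(t)\rightarrow(\exists x)A(x)$, $t$ free for $x$; Q4: $(\forall x)(A(x)\rightarrow B)\rightarrow((\exists x)A(x)\rightarrow B)$, $x$ not free in $B$; jK: $s:(A\rightarrow B)\rightarrow(t:A\rightarrow(s\cdot t):B)$; jT: $t:A\rightarrow A$; j4: $t:A\rightarrow !t:t:A$; Sum: $s:A\rightarrow(s+t):A$, $s:A\rightarrow(t+s):A$; UF: $(\exists y)y:(\forall x)t:A\rightarrow(t\forall x):(\forall x)A$, $y$ not free in $t$ or $A$. Rules: Modus Ponens; Gen; qNec: from $A$ infer $(\exists x)x:A$, $x$ not free in $A$; Axiom Necessitation (from an axiom instance $A$ infer $f(x_1,\dots,x_n):A$). A propositional variable $p$ is $\exists$-justified in a $\mathsf{QLP}$-formula $A(p,\bar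 q)$ if each occurrence of $p$ lies within the scope of a subformula of the form $(\exists x)x:\cdots$ for some variable $x$. $\mathsf{QLP}(\mathsf{FP})$ extends the language by operators $\delta_A(\bar q)$ for each $\mathsf{QLP}$-formula $A(p,\bar q)$ in which $p$ is $\exists$-justified, and adds the axioms $\delta_A(\bar B)\leftrightarrow A(\delta_A(\bar B),\bar B)$ for all lists $\bar B$ of formulas of the extended language. The subscript $\emptyset$ means Axiom Necessitation is dropped. -}

module Defs where

open import Data.Nat using (ℕ; zero; suc; _≡ᵇ_)
open import Data.Bool using (Bool; true; false; not; _∧_; _∨_; if_then_else_; T)
open import Data.List using (List; []; _∷_; _++_; length; filterᵇ; deduplicateᵇ)
open import Data.Vec using (Vec; []; _∷_)
open import Data.Maybe using (Maybe; just; nothing; _>>=_)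
open import Relation.Binary.PropositionalEquality using (_≡_)

-- Justification variables and propositional variables are indexed by ℕ;
-- the primitive function symbols of arity n are f^n_i (i : ℕ), and a
-- primitive term is f^n_i(x₁,…,xₙ) with variables xⱼ as arguments.

infixl 7 _·_
infixl 6 _⊕_

data Tm : Set where
  var  : ℕ → Tm
  prim : (n i : ℕ) → Vec ℕ n → Tm
  _·_  : Tm → Tm → Tm
  _⊕_  : Tm → Tm → Tm
  !_   : Tm → Tm
  uf   : Tm → ℕ → Tm                  -- (t ∀ x), x bound

data QFm : Set where
  pv   : ℕ → QFm
  ⊥q   : QFm
  ¬q   : QFm → QFm
  _∧q_ _∨q_ _⇒q_ : QFm → QFm → QFm
  _∶q_ : Tm → QFm → QFm
  ∀q ∃q : ℕ → QFm → QFm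

-- p is ∃-justified in A: every occurrence of p lies inside a subformula
-- of the form (∃x) x : C.
exJ : ℕ → QFm → Bool
exJ p (pv q) = not (p ≡ᵇ q)
exJ p ⊥q = true
exJ p (¬q A) = exJ p A
exJ p (A ∧q B) = exJ p A ∧ exJ p B
exJ p (A ∨q B) = exJ p A ∧ exJ p B
exJ p (A ⇒q B) = exJ p A ∧ exJ p B
exJ p (t ∶q A) = exJ p A
exJ p (∀q x A) = exJ p A
exJ p (∃q x (var y ∶q A)) = (x ≡ᵇ y) ∨ exJ p A
exJ p (∃q x A) = exJ p A

pvars : QFm → List ℕ
pvars (pv q) = q ∷ []
pvars ⊥q = []
pvars (¬q A) = pvars A
pvars (A ∧q B) = pvars A ++ pvars B
pvars (A ∨q B) = pvars A ++ pvars B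
pvars (A ⇒q B) = pvars A ++ pvars B
pvars (t ∶q A) = pvars A
pvars (∀q x A) = pvars A
pvars (∃q x A) = pvars A

-- the list q̄ of the propositional variables of A(p, q̄) other than p,
-- without repetitions, in order of first occurrence
params : ℕ → QFm → List ℕ
params p A = filterᵇ (λ r → not (p ≡ᵇ r)) (deduplicateᵇ _≡ᵇ_ (pvars A))

-- Formulas of QLP(FP): QLP formulas plus δ_A(B̄) for every QLP formula
-- A(p, q̄) with p ∃-justified, B̄ a list of formulas of length |q̄|.

infixr 4 _⇒_
infixr 6 _∧_ᶠ

data Fm : Set where
  pv   : ℕ → Fm
  ⊥'   : Fm
  ¬'   : Fm → Fm
  _∧_ᶠ _∨'_ _⇒_ : Fm → Fm → Fm
  _∶_  : Tm → Fm → Fm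
  ∀' ∃' : ℕ → Fm → Fm
  δ    : (A : QFm) (p : ℕ) → T (exJ p A) → Vec Fm (length (params p A)) → Fm

_⇔_ : Fm → Fm → Fm
A ⇔ B = (A ⇒ B) ∧ (B ⇒ A) ᶠ

inst : (ℕ → Fm) → QFm → Fm
inst σ (pv q) = σ q
inst σ ⊥q = ⊥'
inst σ (¬q A) = ¬' (inst σ A)
inst σ (A ∧q B) = inst σ A ∧ inst σ B ᶠ
inst σ (A ∨q B) = inst σ A ∨' inst σ B
inst σ (A ⇒q B) = inst σ A ⇒ inst σ B
inst σ (t ∶q A) = t ∶ inst σ A
inst σ (∀q x A) = ∀' x (inst σ A)
inst σ (∃q x A) = ∃' x (inst σ A)

assoc : (qs : List ℕ) → Vec Fm (length qs) → ℕ → Fm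
assoc [] [] r = pv r
assoc (q ∷ qs) (B ∷ Bs) r = if q ≡ᵇ r then B else assoc qs Bs r

-- right-hand side A(δ_A(B̄), B̄) of the fixed-point axiom
fpUnfold : (A : QFm) (p : ℕ) (h : T (exJ p A)) (Bs : Vec Fm (length (params p A))) → Fm
fpUnfold A p h Bs =
  inst (λ r → if p ≡ᵇ r then δ A p h Bs else assoc (params p A) Bs r) A

anyV : ∀ {n} → ℕ → Vec ℕ n → Bool
anyV x [] = false
anyV x (y ∷ ys) = (x ≡ᵇ y) ∨ anyV x ys

freeT : ℕ → Tm → Bool
freeT x (var y) = x ≡ᵇ y
freeT x (prim n i ys) = anyV x ys
freeT x (t · s) = freeT x t ∨ freeT x s
freeT x (t ⊕ s) = freeT x t ∨ freeT x s
freeT x (! t) = freeT x t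
freeT x (uf t y) = not (x ≡ᵇ y) ∧ freeT x t

mutual
  free : ℕ → Fm → Bool
  free x (pv q) = false
  free x ⊥' = false
  free x (¬' A) = free x A
  free x (A ∧ B ᶠ) = free x A ∨ free x B
  free x (A ∨' B) = free x A ∨ free x B
  free x (A ⇒ B) = free x A ∨ free x B
  free x (t ∶ A) = freeT x t ∨ free x A
  free x (∀' y A) = not (x ≡ᵇ y) ∧ free x A
  free x (∃' y A) = not (x ≡ᵇ y) ∧ free x A
  free x (δ A p h Bs) = freeV x Bs

  freeV : ∀ {n} → ℕ → Vec Fm n → Bool
  freeV x [] = false
  freeV x (B ∷ Bs) = free x B ∨ freeV x Bs

-- Returns nothing if t is not free for x, or if the result would not be
-- well formed (a non-variable term in an argument place of a primitive
-- term, which only admits variables).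

substArgs : ∀ {n} → Tm → ℕ → Vec ℕ n → Maybe (Vec ℕ n)
substArgs t x [] = just []
substArgs t x (y ∷ ys) = substArgs t x ys >>= λ ys' →
  if x ≡ᵇ y
  then (argOf t >>= λ z → just (z ∷ ys'))
  else just (y ∷ ys')
  where
  argOf : Tm → Maybe ℕ
  argOf (var z) = just z
  argOf _ = nothing

substT : Tm → ℕ → Tm → Maybe Tm
substT t x (var y) = if x ≡ᵇ y then just t else just (var y)
substT t x (prim n i ys) = substArgs t x ys >>= λ ys' → just (prim n i ys')
substT t x (s · r) = substT t x s >>= λ s' → substT t x r >>= λ r' → just (s' · r')
substT t x (s ⊕ r) = substT t x s >>= λ s' → substT t x r >>= λ r' → just (s' ⊕ r')
substT t x (! s) = substT t x s >>= λ s' → just (! s')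
substT t x (uf s y) =
  if x ≡ᵇ y then just (uf s y)
  else if freeT x s ∧ freeT y t then nothing
  else (substT t x s >>= λ s' → just (uf s' y))

mutual
  subst : Tm → ℕ → Fm → Maybe Fm
  subst t x (pv q) = just (pv q)
  subst t x ⊥' = just ⊥'
  subst t x (¬' A) = subst t x A >>= λ A' → just (¬' A')
  subst t x (A ∧ B ᶠ) = subst t x A >>= λ A' → subst t x B >>= λ B' → just (A' ∧ B' ᶠ)
  subst t x (A ∨' B) = subst t x A >>= λ A' → subst t x B >>= λ B' → just (A' ∨' B')
  subst t x (A ⇒ B) = subst t x A >>= λ A' → subst t x B >>= λ B' → just (A' ⇒ B')
  subst t x (s ∶ A) = substT t x s >>= λ s' → subst t x A >>= λ A' → just (s' ∶ A')
  subst t x (∀' y A) =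
    if x ≡ᵇ y then just (∀' y A)
    else if free x A ∧ freeT y t then nothing
    else (subst t x A >>= λ A' → just (∀' y A'))
  subst t x (∃' y A) =
    if x ≡ᵇ y then just (∃' y A)
    else if free x A ∧ freeT y t then nothing
    else (subst t x A >>= λ A' → just (∃' y A'))
  subst t x (δ A p h Bs) = substV t x Bs >>= λ Bs' → just (δ A p h Bs')

  substV : ∀ {n} → Tm → ℕ → Vec Fm n → Maybe (Vec Fm n)
  substV t x [] = just []
  substV t x (B ∷ Bs) = subst t x B >>= λ B' → substV t x Bs >>= λ Bs' → just (B' ∷ Bs')

-- Propositional tautologies: formulas true under every Boolean valuation
-- of their prime (non-connective) subformulas.

eval : (Fm → Bool) → Fm → Bool
eval v ⊥' = false
eval v (¬' A) = not (eval v A)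
eval v (A ∧ B ᶠ) = eval v A ∧ eval v B
eval v (A ∨' B) = eval v A ∨ eval v B
eval v (A ⇒ B) = not (eval v A) ∨ eval v B
eval v A = v A

Tautology : Fm → Set
Tautology A = (v : Fm → Bool) → eval v A ≡ true

data Axiom : Fm → Set where
  taut : ∀ {A} → Tautology A → Axiom A
  Q1   : ∀ {A B x t} → subst t x A ≡ just B → Axiom (∀' x A ⇒ B)
  Q2   : ∀ {A B x} → free x A ≡ false → Axiom (∀' x (A ⇒ B) ⇒ (A ⇒ ∀' x B))
  Q3   : ∀ {A B x t} → subst t x A ≡ just B → Axiom (B ⇒ ∃' x A)
  Q4   : ∀ {A B x} → free x B ≡ false → Axiom (∀' x (A ⇒ B) ⇒ (∃' x A ⇒ B))
  jK   : ∀ {s t A B} → Axiom ((s ∶ (A ⇒ B)) ⇒ ((t ∶ A) ⇒ ((s · t) ∶ B)))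
  jT   : ∀ {t A} → Axiom ((t ∶ A) ⇒ A)
  j4   : ∀ {t A} → Axiom ((t ∶ A) ⇒ ((! t) ∶ (t ∶ A)))
  sumˡ : ∀ {s t A} → Axiom ((s ∶ A) ⇒ ((s ⊕ t) ∶ A))
  sumʳ : ∀ {s t A} → Axiom ((s ∶ A) ⇒ ((t ⊕ s) ∶ A))
  UF   : ∀ {t A x y} → freeT y t ≡ false → free y A ≡ false →
         Axiom (∃' y (var y ∶ ∀' x (t ∶ A)) ⇒ (uf t x ∶ ∀' x A))
  FP   : ∀ {A p} (h : T (exJ p A)) (Bs : Vec Fm (length (params p A))) →
         Axiom (δ A p h Bs ⇔ fpUnfold A p h Bs)

-- Theorems of QLP(FP)_∅: Modus Ponens, Gen, qNec; no Axiom Necessitation.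
data ⊢_ : Fm → Set where
  ax   : ∀ {A} → Axiom A → ⊢ A
  mp   : ∀ {A B} → ⊢ (A ⇒ B) → ⊢ A → ⊢ B
  gen  : ∀ {A} x → ⊢ A → ⊢ ∀' x A
  qNec : ∀ {A x} → free x A ≡ false → ⊢ A → ⊢ ∃' x (var x ∶ A)

Inconsistent : Set
Inconsistent = ⊢ ⊥'

-- QLP(FP)_∅ is inconsistent: the fixed-point operators let us write down a
-- "justification liar", a formula D with  D ↔ ¬(∃x) x:D.
--
-- The argument is Löb/Curry-style and uses no Axiom Necessitation:
--   * reflection: for x not free in A, (∃x) x:A → A is provable (jT, Gen, Q4);
--   * so for the liar D, both (∃x) x:D → D and ¬(∃x) x:D → D hold, hence ⊢ D;
--   * qNec turns ⊢ D into ⊢ (∃x) x:D, contradicting D → ¬(∃x) x:D.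

module Submission where

open import Defs
open import Data.Nat using (ℕ)
open import Data.Bool using (true; false)
open import Data.Vec using ([])
open import Relation.Binary.PropositionalEquality using (_≡_; refl)

justified : ℕ → Fm → Fm
justified x A = ∃' x (var x ∶ A)

taut-mp : ∀ {A B} → Tautology (A ⇒ B) → ⊢ A → ⊢ B
taut-mp t ⊢A = mp (ax (taut t)) ⊢A

reflection : ∀ {A} x → free x A ≡ false → ⊢ (justified x A ⇒ A)
reflection {A} x x∉A = mp (ax (Q4 {var x ∶ A} {A} {x} x∉A)) (gen x (ax jT))

liar-true : ∀ D E → Tautology ((D ⇔ ¬' E) ⇒ ((E ⇒ D) ⇒ D))
liar-true D E v with eval v D | eval v E
... | true  | true  = refl
... | true  | false = refl
... | false | true  = refl
... | false | false = refl

liar-absurd : ∀ D E → Tautology ((D ⇔ ¬' E) ⇒ (D ⇒ (E ⇒ ⊥')))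
liar-absurd D E v with eval v D | eval v E
... | true  | true  = refl
... | true  | false = refl
... | false | true  = refl
... | false | false = refl

liar-inconsistent : ∀ {D} x → free x D ≡ false →
                    ⊢ (D ⇔ ¬' (justified x D)) → ⊢ ⊥'
liar-inconsistent {D} x x∉D liar =
  mp (mp (taut-mp (liar-absurd D E) liar) ⊢D) ⊢justifiedD
  where
  E : Fm
  E = justified x D

  ⊢D : ⊢ D
  ⊢D = mp (taut-mp (liar-true D E) liar) (reflection x x∉D)

  ⊢justifiedD : ⊢ E
  ⊢justifiedD = qNec x∉D ⊢D

-- The liar template L(p) = ¬(∃x₀) x₀:p; p = p₀ is ∃-justified in it and it
-- has no other propositional variables.
liar-template : QFm
liar-template = ¬q (∃q 0 (var 0 ∶q pv 0))

liar : Fm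
liar = δ liar-template 0 _ []

-- The fixed-point axiom for δ_L is literally the liar equivalence.
liar-equivalence : ⊢ (liar ⇔ ¬' (justified 0 liar))
liar-equivalence = ax (FP {liar-template} {0} _ [])

corollary3 : ⊢ ⊥'
corollary3 = liar-inconsistent 0 refl liar-equivalence
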